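{- Fix an alphabet $\Sigma$ and let $F_{\mathrm{da}}=2\times(-)^\Sigma\colon\mathbf{Set}\to\mathbf{Set}$ with $2=\{\mathrm{false},\mathrm{true}\}$. Let $A=\Sigma\uplus\{\epsilon\}$, and define $\tau_a\colon F_{\mathrm{da}}2\to2$ by $\tau_\epsilon(t,\rho)=t$ and $\tau_a(t,\rho)=\rho(a)$ for $a\in\Sigma$; let $\sigma_a=\wedge\colon2\times2\to2$ (conjunction) for all $a\in A$; and let $\lambda^{\mathrm{da}}_{X,Y}\colon F_{\mathrm{da}}X\times F_{\mathrm{da}}Y\to F_{\mathrm{da}}(X\times Y)$ be $\lambda^{\mathrm{da}}_{X,Y}((t_1,\rho_1),(t_2,\rho_2))=(t_1\wedge t_2,\ \lambda a.(\rho_1(a),\rho_2(a)))$. Working in $\mathbf{EqRel}$ (sets with equivalence relations, relation-preserving maps) with truth value $\mathrm{Eq}_2=(2,\text{equality})$ for every $a\in A$, define for $(X,R),(Y,S)\in\mathbf{EqRel}$: $\dot F(X,R)=\big(F_{\mathrm{da}}X,\{(u,v)\mid\tau_a(F_{\mathrm{da}}k(u))=\tau_a(F_{\mathrm{da}}k(v))\ \text{for all }a\in A\text{ and relation-preserving }k\colon(X,R)\to\mathrm{Eq}_2\}\big)$, $(X,R)\dot\times(Y,S)=\big(X\times Y,\{((x,y),(x',y'))\mid k(x)\wedge l(y)=k(x')\wedge l(y')\ \text{for all relation-preserving }k\colon(X,R)\to\mathrm{Eq}_2,\ l\colon(Y,S)\to\mathrm{Eq}_2\}\big)$. Then $\sigma$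 lifts $\lambda^{\mathrm{da}}$ along the forgetful functor $\mathbf{EqRel}\to\mathbf{Set}$: for all $(X,R),(Y,S)$, $\lambda^{\mathrm{da}}_{X,Y}$ is relation-preserving from $\dot F(X,R)\,\dot\times\,\dot F(Y,S)$ to $\dot F((X,R)\dot\times(Y,S))$.
   Context: $\dot F$ is the codensity lifting of $F_{\mathrm{da}}$ with modalities $\tau$ and $\dot\times$ is the 2-codensity lifting of binary product with modality $\wedge$ (the $2$-codensity lifting with $\sigma_a=\wedge$ for every $a$ coincides with the single-modality one). $F_{\mathrm{da}}k(t,\rho)=(t,k\circ\rho)$. -}

module Defs where

open import Data.Bool using (Bool; true; false; _∧_)
open import Data.Product using (_×_; _,_; proj₁; proj₂)
open import Data.Sum using (_⊎_; inj₁; inj₂)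
open import Data.Unit using (⊤; tt)
open import Relation.Binary.PropositionalEquality using (_≡_)
open import Relation.Binary.Structures using (IsEquivalence)

record EqRel : Set₁ where
  field
    Carrier : Set
    Rel     : Carrier → Carrier → Set
    isEquiv : IsEquivalence Rel
open EqRel public

Eq₂ : EqRel
Eq₂ = record { Carrier = Bool ; Rel = _≡_ ; isEquiv = Relation.Binary.PropositionalEquality.isEquivalence }
  where import Relation.Binary.PropositionalEquality

Preserves : (P Q : EqRel) → (Carrier P → Carrier Q) → Set
Preserves P Q f = ∀ {x y} → Rel P x y → Rel Q (f x) (f y)

Fda : (Σ : Set) → Set → Set
Fda Σ X = Bool × (Σ → X)

Fda-map : (Σ : Set) {X Y : Set} → (X → Y) → Fda Σ X → Fda Σ Y
Fda-map Σ k (t , ρ) = (t , λ a → k (ρ a))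

A : Set → Set
A Σ = Σ ⊎ ⊤

τ : (Σ : Set) → A Σ → Fda Σ Bool → Bool
τ Σ (inj₁ a)  (t , ρ) = ρ a
τ Σ (inj₂ tt) (t , ρ) = t

λda : (Σ : Set) {X Y : Set} → Fda Σ X × Fda Σ Y → Fda Σ (X × Y)
λda Σ ((t₁ , ρ₁) , (t₂ , ρ₂)) = (t₁ ∧ t₂ , λ a → (ρ₁ a , ρ₂ a))

FdotRel : (Σ : Set) (P : EqRel) → Fda Σ (Carrier P) → Fda Σ (Carrier P) → Set
FdotRel Σ P u v =
  (a : A Σ) (k : Carrier P → Bool) → Preserves P Eq₂ k →
  τ Σ a (Fda-map Σ k u) ≡ τ Σ a (Fda-map Σ k v)

ProdRel : (P Q : EqRel) → Carrier P × Carrier Q → Carrier P × Carrier Q → Set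
ProdRel P Q (x , y) (x′ , y′) =
  (k : Carrier P → Bool) → Preserves P Eq₂ k →
  (l : Carrier Q → Bool) → Preserves Q Eq₂ l →
  (k x ∧ l y) ≡ (k x′ ∧ l y′)

open import Relation.Binary.PropositionalEquality using (refl; sym; trans)

Fdot : (Σ : Set) → EqRel → EqRel
Fdot Σ P = record
  { Carrier = Fda Σ (Carrier P)
  ; Rel = FdotRel Σ P
  ; isEquiv = record
    { refl = λ a k pk → refl
    ; sym = λ r a k pk → sym (r a k pk)
    ; trans = λ r s a k pk → trans (r a k pk) (s a k pk) } }

_×̇_ : EqRel → EqRel → EqRel
P ×̇ Q = record
  { Carrier = Carrier P × Carrier Q
  ; Rel = ProdRel P Q
  ; isEquiv = record
    { refl = λ k pk l pl → refl
    ; sym = λ r k pk l pl → sym (r k pk l pl)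
    ; trans = λ r s k pk l pl → trans (r k pk l pl) (s k pk l pl) } }

-- The 2-codensity product only ever looks at a pair of points through a pair of
-- tests into Eq₂, so it is functorial in any map along which tests pull back.
-- The termination bit and each evaluation ρ ↦ ρ a are such maps out of Ḟ(X,R),
-- since composing them with a test is one of the observations τ_a ∘ F_da k that
-- define Ḟ; applying this to the two components of λ^da gives the claim.
module Submission where

open import Data.Bool using (true; _∧_)
open import Data.Product using (_,_; proj₁; proj₂; map)
open import Data.Sum using (inj₁; inj₂)
open import Data.Unit using (tt)
open import Function using (_∘_; id)
open import Relation.Binary.PropositionalEquality using (_≡_; refl)

open import Defs

PullsBackTests : (P Q : EqRel) → (Carrier P → Carrier Q) → Set
PullsBackTests P Q f = ∀ {k} → Preserves Q Eq₂ k → Preserves P Eq₂ (k ∘ f)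

preserves⇒pullsBackTests : ∀ {P Q f} → Preserves P Q f → PullsBackTests P Q f
preserves⇒pullsBackTests pf pk = pk ∘ pf

×̇-map-preserves : ∀ {P P′ Q Q′} (f : Carrier P → Carrier P′) (g : Carrier Q → Carrier Q′) →
                  PullsBackTests P P′ f → PullsBackTests Q Q′ g →
                  Preserves (P ×̇ Q) (P′ ×̇ Q′) (map f g)
×̇-map-preserves f g pf pg r k pk l pl = r (k ∘ _) (pf pk) (l ∘ _) (pg pl)

×̇-Eq₂-∧ : ∀ {b₁ b₂ c₁ c₂} → Rel (Eq₂ ×̇ Eq₂) (b₁ , b₂) (c₁ , c₂) → b₁ ∧ b₂ ≡ c₁ ∧ c₂
×̇-Eq₂-∧ r = r id id id id

module _ (Σ : Set) (P : EqRel) where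

  proj₁-preserves : Preserves (Fdot Σ P) Eq₂ proj₁
  proj₁-preserves r = r (inj₂ tt) (λ _ → true) (λ _ → refl)

  proj₁-pullsBackTests : PullsBackTests (Fdot Σ P) Eq₂ proj₁
  proj₁-pullsBackTests = preserves⇒pullsBackTests {Fdot Σ P} {Eq₂} proj₁-preserves

  evaluation-pullsBackTests : (a : Σ) → PullsBackTests (Fdot Σ P) P (λ u → proj₂ u a)
  evaluation-pullsBackTests a {k} pk r = r (inj₁ a) k pk

proposition8 : (Σ : Set) (P Q : EqRel)
    → Preserves (Fdot Σ P ×̇ Fdot Σ Q) (Fdot Σ (P ×̇ Q)) (λda Σ)
proposition8 Σ P Q r (inj₂ tt) k pk =
  ×̇-Eq₂-∧ (×̇-map-preserves {Fdot Σ P} {Eq₂} {Fdot Σ Q} {Eq₂} proj₁ proj₁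
             (proj₁-pullsBackTests Σ P) (proj₁-pullsBackTests Σ Q) r)
proposition8 Σ P Q r (inj₁ a) k pk =
  pk (×̇-map-preserves {Fdot Σ P} {P} {Fdot Σ Q} {Q} (λ u → proj₂ u a) (λ v → proj₂ v a)
        (evaluation-pullsBackTests Σ P a) (evaluation-pullsBackTests Σ Q a) r)
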